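{- Let $Z$ be a multimatroid with a total ordering $\prec$ of its skew classes and let $T$ be a transversal of $Z$. Then: (1) $\mathrm{ccl}_{\prec}(T)$ and $T$ have the same active skew classes; (2) $\mathrm{ccl}_{\prec}(\mathrm{ccl}_{\prec}(T))=\mathrm{ccl}_{\prec}(T)$; (3) $\mathrm{ccl}_{\prec}(T)$ is $(Z,\prec)$-cocompatible.
   Context: A carrier is a pair $(U,\Omega)$, $U$ finite, $\Omega$ a partition of $U$ into non-empty skew classes; subtransversals meet each skew class at most once, transversals exactly once; skew pair: two distinct elements of a skew class. A multimatroid $Z=(U,\Omega,r)$ has a non-negative integer $r$ on subtransversals with (R1) on each transversal $r$ is a matroid rank function; (R2) for subtransversal $S$ and skew pair $\{x,y\}$ in a skew class disjoint from $S$, $r(S\cup\{x\})+r(S\cup\{y\})-2r(S)\ge1$. Circuits are minimal subtransversals $S$ with $r(S)<|S|$. $S_\omega$ is the element of $S\cap\omega$. The total order $\prec$ on skew classes induces an order on any subtransversal; $\min(C)$ is its least element. For a transversal $T$, skew class $\omega$ is active w.r.t. $T$ if there is a circuit $C$ with $\min(C)\in\omega$ and $C-\omega\subseteq T$, inactive otherwise. All such circuits $C$ have the same least element, denoted $\underline T_\omega$. The $\prec$-cocompatible closure $\mathrm{ccl}_\prec(T)$ is the transversal with $(\mathrm{ccl}_\prec(T))_\omega=\underline T_\omega$ if $\omega$ is active w.r.t. $T$ and $=T_\omega$ otherwise. A transversal $S$ is $(Z,\prec)$-cocompatible if no circuit $C$ satisfies $C-S=\{\min(C)\}$. -}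

module Defs where

open import Level using (0ℓ)
open import Data.Nat using (ℕ; _≤_; _<_; _+_; _*_)
open import Data.Fin using (Fin)
open import Data.Fin.Subset using (Subset; _∈_; _∉_; _⊆_; _⊂_; _∪_; _∩_; ⁅_⁆; ∣_∣)
open import Data.Product using (Σ; ∃; _×_; _,_)
open import Data.Sum using (_⊎_)
open import Relation.Binary.Core using (Rel)
open import Relation.Binary.PropositionalEquality using (_≡_; _≢_)
open import Relation.Nullary using (¬_)

-- A carrier (U, Ω): U = Fin m, and the partition Ω of U into non-empty
-- skew classes is given by the map  cls : U → Fin n  sending an element to
-- (the index of) its skew class; surjectivity = skew classes are non-empty.
record Carrier : Set where
  field
    m        : ℕ
    n        : ℕ
    cls      : Fin m → Fin n
    cls-surj : ∀ ω → ∃ λ x → cls x ≡ ω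

module CarrierNotions (C : Carrier) where
  open Carrier C

  IsSubtransversal : Subset m → Set
  IsSubtransversal S = ∀ x y → x ∈ S → y ∈ S → cls x ≡ cls y → x ≡ y

  IsTransversal : Subset m → Set
  IsTransversal T = IsSubtransversal T × (∀ ω → ∃ λ x → x ∈ T × cls x ≡ ω)

  IsMatroidRankOn : (Subset m → ℕ) → Subset m → Set
  IsMatroidRankOn r T =
      (∀ X → X ⊆ T → r X ≤ ∣ X ∣)
    × (∀ X Y → X ⊆ T → Y ⊆ T → X ⊆ Y → r X ≤ r Y)
    × (∀ X Y → X ⊆ T → Y ⊆ T → r (X ∪ Y) + r (X ∩ Y) ≤ r X + r Y)

-- A multimatroid Z = (U, Ω, r).  The rank function is given on all subsets of
-- U, but only its values on subtransversals are constrained/used.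
record Multimatroid : Set where
  field
    carrier : Carrier
  open Carrier carrier public
  open CarrierNotions carrier public
  field
    r  : Subset m → ℕ
    R1 : ∀ T → IsTransversal T → IsMatroidRankOn r T
    R2 : ∀ S x y → IsSubtransversal S → x ≢ y → cls x ≡ cls y
         → (∀ z → z ∈ S → cls z ≢ cls x)
         → 2 * r S + 1 ≤ r (S ∪ ⁅ x ⁆) + r (S ∪ ⁅ y ⁆)

module MultimatroidNotions (Z : Multimatroid) (_≺_ : Rel (Fin (Multimatroid.n Z)) 0ℓ) where
  open Multimatroid Z

  IsCircuit : Subset m → Set
  IsCircuit C = IsSubtransversal C × r C < ∣ C ∣
              × (∀ D → D ⊂ C → ¬ (r D < ∣ D ∣))

  IsMin : Subset m → Fin m → Set
  IsMin C x = x ∈ C × (∀ y → y ∈ C → y ≡ x ⊎ cls x ≺ cls y)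

  ActiveWitness : Subset m → Fin m → Set
  ActiveWitness T x = ∃ λ C → IsCircuit C × IsMin C x
                          × (∀ y → y ∈ C → cls y ≢ cls x → y ∈ T)

  IsActive : Subset m → Fin n → Set
  IsActive T ω = ∃ λ x → cls x ≡ ω × ActiveWitness T x

  -- T' = ccl≺(T): T' is a transversal whose element in skew class ω is
  -- the common least element  T̲_ω  of the circuits witnessing activity of ω
  -- if ω is active w.r.t. T, and is T_ω otherwise.
  IsCcl : Subset m → Subset m → Set
  IsCcl T T' = IsTransversal T'
             × (∀ x → x ∈ T' → (IsActive T (cls x) → ActiveWitness T x)
                              × (¬ IsActive T (cls x) → x ∈ T))

  IsCocompatible : Subset m → Set
  IsCocompatible S = ¬ (∃ λ C → ∃ λ x → IsCircuit C × IsMin C x × x ∉ S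
                          × (∀ y → y ∈ C → y ≢ x → y ∈ S))

-- Inside a transversal r is a matroid rank function, so an element e of a
-- circuit C is spanned by every set containing C - e, and strong circuit
-- elimination holds.  Axiom (R2) forbids two circuits through the members of a
-- skew pair whose remaining elements form a subtransversal; hence the least
-- element T̲_ω is unique and ccl(T) exists.  A T-witness C of x remains a
-- witness for T' = ccl(T): another element of T' in the class of some
-- y ∈ C - x would be a T-witness clashing with C.  Conversely, a circuit with
-- least element x and all other elements in T ∪ T' becomes a T-witness after
-- repeatedly eliminating its ≺-largest element y outside T against the
-- T-witness of y, which exists because y ∈ T' - T.  As every T-witness is the
-- element of T' in its class, idempotence and cocompatibility follow.

module Submission where

open import Defs
open import Level using (Level; 0ℓ)
open import Data.Nat using (ℕ; suc; _≤_; _<_; _+_; _*_; s≤s; _<?_)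
open import Data.Nat.Properties
  using (≤-reflexive; ≤-trans; <-≤-trans; ≤-pred; m≤n⇒m≤1+n; ≮⇒≥; <⇒≱; n≮0;
         +-mono-≤; +-monoʳ-≤; +-cancelʳ-≤; +-identityʳ; m+1+n≰m; module ≤-Reasoning)
open import Data.Nat.Induction using (<-wellFounded)
open import Data.Fin using (Fin) renaming (_≟_ to _≟ᶠ_)
open import Data.Fin.Properties using (any?; all?)
open import Data.Fin.Subset
  using (Subset; _∈_; _∉_; _⊆_; _⊂_; _∪_; _∩_; _─_; _-_; ⁅_⁆; ∣_∣; Nonempty; inside; outside)
open import Data.Fin.Subset.Properties
  using (_∈?_; _⊂?_; nonempty?; anySubset?; x∈p∪q⁺; x∈p∪q⁻; x∈p∩q⁺; p∩q⊆q; x∈⁅x⁆;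
         x∈⁅y⁆⇒x≡y; x∉⁅y⁆⇒x≢y; p⊆p∪q; q⊆p∪q; p─q⊆p; p─⊥≡p; x∈p∧x∉q⇒x∈p─q;
         x∈p∧x≢y⇒x∈p-y; x∈p⇒p-x⊂p; x∈p⇒∣p-x∣<∣p∣; p⊂q⇒∣p∣<∣q∣; ⊆-refl; ⊆-trans;
         ⊆-antisym; Empty-unique; ∣⊥∣≡0)
open import Data.List using (allFin; filter)
open import Data.List.Relation.Unary.All using (lookup)
open import Data.List.Relation.Unary.All.Properties using (all-filter)
open import Data.List.Membership.Propositional.Properties using (∈-allFin; ∈-filter⁺)
import Data.List.Extrema
open import Data.Vec using (_∷_; here; there; tabulate)
open import Data.Vec.Properties using (lookup∘tabulate; []=⇒lookup; lookup⇒[]=)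
open import Data.Product using (∃; _×_; _,_; proj₁; proj₂)
open import Data.Sum using (_⊎_; inj₁; inj₂; [_,_]′)
open import Data.Empty using (⊥-elim)
open import Function using (id; _∘_; _on_)
open import Function.Bundles using (_⇔_; mk⇔)
open import Induction.WellFounded using (Acc; acc; WellFounded; module Subrelation)
open import Relation.Binary.Construct.On as On using ()
open import Relation.Nullary using (¬_; Dec; yes; no; does)
open import Relation.Nullary.Decidable
  using (_×-dec_; _⊎-dec_; _→-dec_; ¬?; map′; dec-true; decidable-stable)
open import Relation.Binary.Core using (Rel)
open import Relation.Binary.Structures using (IsStrictTotalOrder)
open import Relation.Binary.Bundles using (StrictTotalOrder)
import Relation.Binary.Properties.StrictTotalOrder
open import Relation.Binary.PropositionalEquality
  using (_≡_; _≢_; refl; sym; trans; cong; subst)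

x∈p─q⇒x∉q : ∀ {k} {p q : Subset k} {x} → x ∈ p ─ q → x ∉ q
x∈p─q⇒x∉q {p = _ ∷ _} {_ ∷ _}      (there x∈p─q) (there x∈q) = x∈p─q⇒x∉q x∈p─q x∈q
x∈p─q⇒x∉q {p = _ ∷ _} {inside ∷ _} ()            here

∣p∣≤1+∣p-x∣ : ∀ {k} (p : Subset k) x → ∣ p ∣ ≤ suc ∣ p - x ∣
∣p∣≤1+∣p-x∣ (inside  ∷ p) Fin.zero    = s≤s (≤-reflexive (cong ∣_∣ (sym (p─⊥≡p p))))
∣p∣≤1+∣p-x∣ (outside ∷ p) Fin.zero    = m≤n⇒m≤1+n (≤-reflexive (cong ∣_∣ (sym (p─⊥≡p p))))
∣p∣≤1+∣p-x∣ (inside  ∷ p) (Fin.suc x) = s≤s (∣p∣≤1+∣p-x∣ p x)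
∣p∣≤1+∣p-x∣ (outside ∷ p) (Fin.suc x) = ∣p∣≤1+∣p-x∣ p x

module _ {k : ℕ} where

  select : {P : Fin k → Set} → (∀ x → Dec (P x)) → Subset k
  select P? = tabulate (does ∘ P?)

  ∈-select⁺ : ∀ {P : Fin k → Set} (P? : ∀ x → Dec (P x)) {x} → P x → x ∈ select P?
  ∈-select⁺ P? {x} px = lookup⇒[]= x _ (trans (lookup∘tabulate (does ∘ P?) x) (dec-true (P? x) px))

  ∈-select⁻ : ∀ {P : Fin k → Set} (P? : ∀ x → Dec (P x)) {x} → x ∈ select P? → P x
  ∈-select⁻ P? {x} x∈ with P? x | trans (sym (lookup∘tabulate (does ∘ P?) x)) ([]=⇒lookup x∈)
  ... | yes px | _  = px
  ... | no _   | ()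

  ∪-lub : ∀ {p q s : Subset k} → p ⊆ s → q ⊆ s → p ∪ q ⊆ s
  ∪-lub {p} {q} p⊆s q⊆s x∈ = [ p⊆s , q⊆s ]′ (x∈p∪q⁻ p q x∈)

  ∪-mono : ∀ {p p′ q q′ : Subset k} → p ⊆ p′ → q ⊆ q′ → p ∪ q ⊆ p′ ∪ q′
  ∪-mono {q′ = q′} p⊆p′ q⊆q′ = ∪-lub (p⊆p∪q q′ ∘ p⊆p′) (q⊆p∪q _ q′ ∘ q⊆q′)

  ⁅x⁆⊆ : ∀ {x} {p : Subset k} → x ∈ p → ⁅ x ⁆ ⊆ p
  ⁅x⁆⊆ {x} {p} x∈p y∈ = subst (_∈ p) (sym (x∈⁅y⁆⇒x≡y x y∈)) x∈p

  x∈p─q⁻ : ∀ {p q : Subset k} {x} → x ∈ p ─ q → x ∈ p × x ∉ q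
  x∈p─q⁻ {p} {q} x∈ = p─q⊆p p q x∈ , x∈p─q⇒x∉q x∈

  x∈p-y⁻ : ∀ {p : Subset k} {x y} → x ∈ p - y → x ∈ p × x ≢ y
  x∈p-y⁻ x∈ = proj₁ (x∈p─q⁻ x∈) , x∉⁅y⁆⇒x≢y (proj₂ (x∈p─q⁻ x∈))

  -‿mono : ∀ {p q : Subset k} {x} → p ⊆ q → p - x ⊆ q - x
  -‿mono p⊆q z∈ = x∈p∧x≢y⇒x∈p-y (p⊆q (proj₁ (x∈p-y⁻ z∈))) (proj₂ (x∈p-y⁻ z∈))

  p⊆p-x∪⁅x⁆ : ∀ {p : Subset k} x → p ⊆ (p - x) ∪ ⁅ x ⁆
  p⊆p-x∪⁅x⁆ x {z} z∈p with z ≟ᶠ x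
  ... | yes refl = x∈p∪q⁺ (inj₂ (x∈⁅x⁆ z))
  ... | no z≢x = x∈p∪q⁺ (inj₁ (x∈p∧x≢y⇒x∈p-y z∈p z≢x))

  ⊂-wellFounded : WellFounded (_⊂_ {k})
  ⊂-wellFounded = Subrelation.wellFounded p⊂q⇒∣p∣<∣q∣ (On.wellFounded ∣_∣ <-wellFounded)

module _ {a ℓ : Level} {A : Set a} {_<_ : Rel A ℓ} (sto : IsStrictTotalOrder _≡_ _<_) where
  open IsStrictTotalOrder sto using (irrefl; asym)

  private
    strictTotalOrder : StrictTotalOrder a a ℓ
    strictTotalOrder = record { isStrictTotalOrder = sto }

  open Relation.Binary.Properties.StrictTotalOrder strictTotalOrder using (totalOrder)
  open Data.List.Extrema totalOrder using (argmax; argmax-all; f[xs]≤f[argmax])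

  maximal-element : ∀ {k} (f : Fin k → A) {S : Subset k} → Nonempty S
                  → ∃ λ y → y ∈ S × (∀ {z} → z ∈ S → ¬ (f y < f z))
  maximal-element {k} f {S} (y₀ , y₀∈S) =
    y , argmax-all f y₀∈S (all-filter (_∈? S) (allFin k)) , maximal
    where
    y = argmax f y₀ (filter (_∈? S) (allFin k))
    maximal : ∀ {z} → z ∈ S → ¬ (f y < f z)
    maximal {z} z∈S y<z
      with lookup (f[xs]≤f[argmax] y₀ (filter (_∈? S) (allFin k))) (∈-filter⁺ (_∈? S) (∈-allFin z) z∈S)
    ... | inj₁ z<y = asym y<z z<y
    ... | inj₂ z≡y = irrefl (sym z≡y) y<z

module Transversals (K : Carrier) where
  open Carrier K
  open CarrierNotions K

  IsSubtransversal? : ∀ S → Dec (IsSubtransversal S)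
  IsSubtransversal? S =
    all? λ x → all? λ y → (x ∈? S) →-dec (y ∈? S) →-dec (cls x ≟ᶠ cls y) →-dec (x ≟ᶠ y)

  subtransversal-⊆ : ∀ {A B} → IsSubtransversal B → A ⊆ B → IsSubtransversal A
  subtransversal-⊆ st A⊆B x y x∈A y∈A = st x y (A⊆B x∈A) (A⊆B y∈A)

  distinct-classes : ∀ {S x y} → IsSubtransversal S → x ∈ S → y ∈ S → x ≢ y → cls x ≢ cls y
  distinct-classes st x∈S y∈S x≢y cx≡cy = x≢y (st _ _ x∈S y∈S cx≡cy)

  subtransversal-∪ : ∀ {A B} → IsSubtransversal A → IsSubtransversal B
                   → (∀ {u v} → u ∈ A → v ∈ B → cls u ≡ cls v → u ≡ v)
                   → IsSubtransversal (A ∪ B)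
  subtransversal-∪ {A} {B} stA stB agree u v u∈ v∈ cu≡cv with x∈p∪q⁻ A B u∈ | x∈p∪q⁻ A B v∈
  ... | inj₁ u∈A | inj₁ v∈A = stA u v u∈A v∈A cu≡cv
  ... | inj₁ u∈A | inj₂ v∈B = agree u∈A v∈B cu≡cv
  ... | inj₂ u∈B | inj₁ v∈A = sym (agree v∈A u∈B (sym cu≡cv))
  ... | inj₂ u∈B | inj₂ v∈B = stB u v u∈B v∈B cu≡cv

  subtransversal-∪⁅⁆ : ∀ {S e} → IsSubtransversal S → (∀ z → z ∈ S → cls z ≢ cls e)
                     → IsSubtransversal (S ∪ ⁅ e ⁆)
  subtransversal-∪⁅⁆ {S} {e} st avoids = subtransversal-∪ st singleton agree
    where
    singleton : IsSubtransversal ⁅ e ⁆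
    singleton u v u∈ v∈ _ = trans (x∈⁅y⁆⇒x≡y e u∈) (sym (x∈⁅y⁆⇒x≡y e v∈))
    agree : ∀ {u v} → u ∈ S → v ∈ ⁅ e ⁆ → cls u ≡ cls v → u ≡ v
    agree {u} u∈S v∈ cu≡cv = ⊥-elim (avoids u u∈S (trans cu≡cv (cong cls (x∈⁅y⁆⇒x≡y e v∈))))

  -- Add the representative given by cls-surj of every class that S misses.
  extend-to-transversal : ∀ {S} → IsSubtransversal S → ∃ λ T → IsTransversal T × S ⊆ T
  extend-to-transversal {S} st = select In? , (st′ , covers) , ∈-select⁺ In? ∘ inj₁
    where
    representative : Fin n → Fin m
    representative ω = proj₁ (cls-surj ω)
    Met : Fin n → Set
    Met ω = ∃ λ u → u ∈ S × cls u ≡ ω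
    Met? : ∀ ω → Dec (Met ω)
    Met? ω = any? λ u → (u ∈? S) ×-dec (cls u ≟ᶠ ω)
    In : Fin m → Set
    In w = w ∈ S ⊎ (¬ Met (cls w) × w ≡ representative (cls w))
    In? : ∀ w → Dec (In w)
    In? w = (w ∈? S) ⊎-dec (¬? (Met? (cls w)) ×-dec (w ≟ᶠ representative (cls w)))
    st′ : IsSubtransversal (select In?)
    st′ x y x∈ y∈ cx≡cy with ∈-select⁻ In? x∈ | ∈-select⁻ In? y∈
    ... | inj₁ x∈S          | inj₁ y∈S          = st x y x∈S y∈S cx≡cy
    ... | inj₁ x∈S          | inj₂ (unmet , _)  = ⊥-elim (unmet (x , x∈S , cx≡cy))
    ... | inj₂ (unmet , _)  | inj₁ y∈S          = ⊥-elim (unmet (y , y∈S , sym cx≡cy))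
    ... | inj₂ (_ , x≡rep)  | inj₂ (_ , y≡rep)  =
      trans x≡rep (trans (cong representative cx≡cy) (sym y≡rep))
    covers : ∀ ω → ∃ λ x → x ∈ select In? × cls x ≡ ω
    covers ω with Met? ω
    ... | yes (u , u∈S , cu≡ω) = u , ∈-select⁺ In? (inj₁ u∈S) , cu≡ω
    ... | no unmet = representative ω , ∈-select⁺ In? (inj₂ (unmet ∘ subst Met c≡ω , cong representative (sym c≡ω))) , c≡ω
      where
      c≡ω = proj₂ (cls-surj ω)

  transversal-⊆⇒≡ : ∀ {A B} → IsTransversal A → IsSubtransversal B → A ⊆ B → A ≡ B
  transversal-⊆⇒≡ {A} {B} (_ , coversA) stB A⊆B = ⊆-antisym A⊆B B⊆A
    where
    B⊆A : B ⊆ A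
    B⊆A {x} x∈B with coversA (cls x)
    ... | y , y∈A , cy≡cx = subst (_∈ A) (stB y x (A⊆B y∈A) x∈B cy≡cx) y∈A

module Circuits (Z : Multimatroid) (_≺_ : Rel (Fin (Multimatroid.n Z)) 0ℓ) where
  open Multimatroid Z
  open MultimatroidNotions Z _≺_
  open Transversals carrier
  open ≤-Reasoning

  circuit⇒subtransversal : ∀ {C} → IsCircuit C → IsSubtransversal C
  circuit⇒subtransversal = proj₁

  circuit-nonempty : ∀ {C} → IsCircuit C → Nonempty C
  circuit-nonempty {C} (_ , dependent , _) with nonempty? C
  ... | yes nonempty = nonempty
  ... | no empty = ⊥-elim (n≮0 (subst (r C <_) (trans (cong ∣_∣ (Empty-unique empty)) (∣⊥∣≡0 m)) dependent))

  ⊂circuit⇒independent : ∀ {C D} → IsCircuit C → D ⊂ C → ∣ D ∣ ≤ r D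
  ⊂circuit⇒independent (_ , _ , minimal) D⊂C = ≮⇒≥ (minimal _ D⊂C)

  IsCircuit? : ∀ C → Dec (IsCircuit C)
  IsCircuit? C = IsSubtransversal? C ×-dec (r C <? ∣ C ∣) ×-dec minimal?
    where
    minimal? : Dec (∀ D → D ⊂ C → ¬ (r D < ∣ D ∣))
    minimal? = map′ (λ none D D⊂C dep → none (D , D⊂C , dep)) (λ all (D , D⊂C , dep) → all D D⊂C dep)
                    (¬? (anySubset? λ D → (D ⊂? C) ×-dec (r D <? ∣ D ∣)))

  dependent⇒circuit : ∀ {B} → IsSubtransversal B → r B < ∣ B ∣ → ∃ λ C → IsCircuit C × C ⊆ B
  dependent⇒circuit {B} = search (⊂-wellFounded B)
    where
    search : ∀ {B} → Acc _⊂_ B → IsSubtransversal B → r B < ∣ B ∣ → ∃ λ C → IsCircuit C × C ⊆ B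
    search {B} (acc smaller) st dep with anySubset? (λ D → (D ⊂? B) ×-dec (r D <? ∣ D ∣))
    ... | no none = B , (st , dep , λ D D⊂B D-dep → none (D , D⊂B , D-dep)) , id
    ... | yes (D , D⊂B , D-dep) =
      let C , cC , C⊆D = search (smaller D⊂B) (subtransversal-⊆ st (proj₁ D⊂B)) D-dep
      in C , cC , ⊆-trans C⊆D (proj₁ D⊂B)

  -- (R1) constrains r only on subsets of a transversal, so rank arguments happen inside one.
  module InTransversal (T₀ : Subset m) (trT₀ : IsTransversal T₀) where

    rank≤size : ∀ {X} → X ⊆ T₀ → r X ≤ ∣ X ∣
    rank≤size {X} = proj₁ (R1 T₀ trT₀) X

    rank-mono : ∀ {X Y} → X ⊆ T₀ → Y ⊆ T₀ → X ⊆ Y → r X ≤ r Y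
    rank-mono {X} {Y} = proj₁ (proj₂ (R1 T₀ trT₀)) X Y

    rank-submodular : ∀ {X Y} → X ⊆ T₀ → Y ⊆ T₀ → r (X ∪ Y) + r (X ∩ Y) ≤ r X + r Y
    rank-submodular {X} {Y} = proj₂ (proj₂ (R1 T₀ trT₀)) X Y

    circuit-spans : ∀ {C Y e} → IsCircuit C → C ⊆ T₀ → Y ⊆ T₀ → e ∈ C → C - e ⊆ Y
                  → r (Y ∪ ⁅ e ⁆) ≤ r Y
    circuit-spans {C} {Y} {e} cC C⊆T₀ Y⊆T₀ e∈C C-e⊆Y = begin
      r (Y ∪ ⁅ e ⁆) ≤⟨ rank-mono (∪-lub Y⊆T₀ (⁅x⁆⊆ (C⊆T₀ e∈C))) (∪-lub Y⊆T₀ C⊆T₀) (∪-mono ⊆-refl (⁅x⁆⊆ e∈C)) ⟩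
      r (Y ∪ C)     ≤⟨ +-cancelʳ-≤ (r (Y ∩ C)) (r (Y ∪ C)) (r Y) submodular ⟩
      r Y           ∎
      where
      C-e⊆Y∩C : C - e ⊆ Y ∩ C
      C-e⊆Y∩C z∈ = x∈p∩q⁺ (C-e⊆Y z∈ , p─q⊆p C ⁅ e ⁆ z∈)
      -- C has the rank of its independent part C - e
      rC≤r[Y∩C] : r C ≤ r (Y ∩ C)
      rC≤r[Y∩C] = begin
        r C       ≤⟨ ≤-pred (<-≤-trans (proj₁ (proj₂ cC)) (∣p∣≤1+∣p-x∣ C e)) ⟩
        ∣ C - e ∣ ≤⟨ ⊂circuit⇒independent cC (x∈p⇒p-x⊂p e∈C) ⟩
        r (C - e) ≤⟨ rank-mono (⊆-trans (p─q⊆p C ⁅ e ⁆) C⊆T₀) (⊆-trans (p∩q⊆q Y C) C⊆T₀) C-e⊆Y∩C ⟩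
        r (Y ∩ C) ∎
      submodular : r (Y ∪ C) + r (Y ∩ C) ≤ r Y + r (Y ∩ C)
      submodular = ≤-trans (rank-submodular Y⊆T₀ C⊆T₀) (+-monoʳ-≤ (r Y) rC≤r[Y∩C])

    circuit-element-drop : ∀ {C Y e} → IsCircuit C → C ⊆ Y → Y ⊆ T₀ → e ∈ C → r Y ≤ r (Y - e)
    circuit-element-drop {C} {Y} {e} cC C⊆Y Y⊆T₀ e∈C = begin
      r Y               ≤⟨ rank-mono Y⊆T₀ (∪-lub Y-e⊆T₀ (⁅x⁆⊆ (Y⊆T₀ (C⊆Y e∈C)))) (p⊆p-x∪⁅x⁆ e) ⟩
      r ((Y - e) ∪ ⁅ e ⁆) ≤⟨ circuit-spans cC (⊆-trans C⊆Y Y⊆T₀) Y-e⊆T₀ e∈C (-‿mono C⊆Y) ⟩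
      r (Y - e)         ∎
      where
      Y-e⊆T₀ = ⊆-trans (p─q⊆p Y ⁅ e ⁆) Y⊆T₀

    circuit⊆⇒dependent : ∀ {C Y} → IsCircuit C → C ⊆ Y → Y ⊆ T₀ → r Y < ∣ Y ∣
    circuit⊆⇒dependent {C} {Y} cC C⊆Y Y⊆T₀ with circuit-nonempty cC
    ... | e , e∈C = begin-strict
      r Y       ≤⟨ circuit-element-drop cC C⊆Y Y⊆T₀ e∈C ⟩
      r (Y - e) ≤⟨ rank≤size (⊆-trans (p─q⊆p Y ⁅ e ⁆) Y⊆T₀) ⟩
      ∣ Y - e ∣ <⟨ x∈p⇒∣p-x∣<∣p∣ (C⊆Y e∈C) ⟩
      ∣ Y ∣     ∎

    independent-spanned⇒circuit : ∀ {Y x} → Y ⊆ T₀ → x ∈ T₀ → x ∉ Y → ∣ Y ∣ ≤ r Y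
                                → r (Y ∪ ⁅ x ⁆) ≤ r Y → ∃ λ K → IsCircuit K × x ∈ K × K ⊆ Y ∪ ⁅ x ⁆
    independent-spanned⇒circuit {Y} {x} Y⊆T₀ x∈T₀ x∉Y independent spanned
      with dependent⇒circuit (subtransversal-⊆ (proj₁ trT₀) Y∪x⊆T₀) Y∪x-dependent
      where
      Y∪x⊆T₀ = ∪-lub Y⊆T₀ (⁅x⁆⊆ x∈T₀)
      Y∪x-dependent : r (Y ∪ ⁅ x ⁆) < ∣ Y ∪ ⁅ x ⁆ ∣
      Y∪x-dependent = begin-strict
        r (Y ∪ ⁅ x ⁆)     ≤⟨ spanned ⟩
        r Y               ≤⟨ rank≤size Y⊆T₀ ⟩
        ∣ Y ∣             <⟨ p⊂q⇒∣p∣<∣q∣ (p⊆p∪q ⁅ x ⁆ , x , x∈p∪q⁺ (inj₂ (x∈⁅x⁆ x)) , x∉Y) ⟩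
        ∣ Y ∪ ⁅ x ⁆ ∣     ∎
    ... | K , cK , K⊆Y∪x with x ∈? K
    ...   | yes x∈K = K , cK , x∈K , K⊆Y∪x
    ...   | no x∉K = ⊥-elim (<⇒≱ (circuit⊆⇒dependent cK K⊆Y Y⊆T₀) independent)
      where
      K⊆Y : K ⊆ Y
      K⊆Y z∈K = [ id , (λ z∈x → ⊥-elim (x∉K (subst (_∈ K) (x∈⁅y⁆⇒x≡y x z∈x) z∈K))) ]′
                (x∈p∪q⁻ Y ⁅ x ⁆ (K⊆Y∪x z∈K))

    -- While Y is dependent, drop an element of a circuit inside Y: this keeps x spanned.
    fundamental-circuit : ∀ {Y x} → Y ⊆ T₀ → x ∈ T₀ → x ∉ Y → r (Y ∪ ⁅ x ⁆) ≤ r Y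
                        → ∃ λ K → IsCircuit K × x ∈ K × K ⊆ Y ∪ ⁅ x ⁆
    fundamental-circuit {Y} = shrink (⊂-wellFounded Y)
      where
      shrink : ∀ {Y x} → Acc _⊂_ Y → Y ⊆ T₀ → x ∈ T₀ → x ∉ Y → r (Y ∪ ⁅ x ⁆) ≤ r Y
             → ∃ λ K → IsCircuit K × x ∈ K × K ⊆ Y ∪ ⁅ x ⁆
      shrink {Y} {x} (acc smaller) Y⊆T₀ x∈T₀ x∉Y spanned with r Y <? ∣ Y ∣
      ... | no Y-independent = independent-spanned⇒circuit Y⊆T₀ x∈T₀ x∉Y (≮⇒≥ Y-independent) spanned
      ... | yes Y-dependent =
        let C , cC , C⊆Y = dependent⇒circuit (subtransversal-⊆ (proj₁ trT₀) Y⊆T₀) Y-dependent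
            e , e∈C = circuit-nonempty cC
            Y-e⊆Y = p─q⊆p Y ⁅ e ⁆
            Y-e⊆T₀ = ⊆-trans Y-e⊆Y Y⊆T₀
            spanned′ = begin
              r ((Y - e) ∪ ⁅ x ⁆) ≤⟨ rank-mono (∪-lub Y-e⊆T₀ (⁅x⁆⊆ x∈T₀)) (∪-lub Y⊆T₀ (⁅x⁆⊆ x∈T₀)) (∪-mono Y-e⊆Y ⊆-refl) ⟩
              r (Y ∪ ⁅ x ⁆)     ≤⟨ spanned ⟩
              r Y               ≤⟨ circuit-element-drop cC C⊆Y Y⊆T₀ e∈C ⟩
              r (Y - e)         ∎
            K , cK , x∈K , K⊆ = shrink (smaller (x∈p⇒p-x⊂p (C⊆Y e∈C))) Y-e⊆T₀ x∈T₀ (x∉Y ∘ Y-e⊆Y) spanned′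
        in K , cK , x∈K , ⊆-trans K⊆ (∪-mono Y-e⊆Y ⊆-refl)

    strong-circuit-elimination : ∀ {C D x y} → IsCircuit C → IsCircuit D → C ⊆ T₀ → D ⊆ T₀
                               → x ∈ C → x ∉ D → y ∈ C → y ∈ D
                               → ∃ λ K → IsCircuit K × x ∈ K × K ⊆ (C ∪ D) - y
    strong-circuit-elimination {C} {D} {x} {y} cC cD C⊆T₀ D⊆T₀ x∈C x∉D y∈C y∈D =
      let K , cK , x∈K , K⊆X∪x = fundamental-circuit X⊆T₀ (C⊆T₀ x∈C) x∉X x-spanned
      in K , cK , x∈K , ⊆-trans K⊆X∪x (∪-lub (p─q⊆p _ ⁅ x ⁆) (⁅x⁆⊆ x∈C∪D-y))
      where
      X = (C ∪ D) - y - x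
      X⊆T₀ : X ⊆ T₀
      X⊆T₀ = ⊆-trans (p─q⊆p _ ⁅ x ⁆) (⊆-trans (p─q⊆p _ ⁅ y ⁆) (∪-lub C⊆T₀ D⊆T₀))
      x∉X : x ∉ X
      x∉X x∈X = proj₂ (x∈p-y⁻ x∈X) refl
      x∈C∪D-y : x ∈ (C ∪ D) - y
      x∈C∪D-y = x∈p∧x≢y⇒x∈p-y (x∈p∪q⁺ (inj₁ x∈C)) (λ x≡y → x∉D (subst (_∈ D) (sym x≡y) y∈D))
      D-y⊆X : D - y ⊆ X
      D-y⊆X z∈ = let z∈D , z≢y = x∈p-y⁻ z∈ in
        x∈p∧x≢y⇒x∈p-y (x∈p∧x≢y⇒x∈p-y (x∈p∪q⁺ (inj₂ z∈D)) z≢y) (λ z≡x → x∉D (subst (_∈ D) z≡x z∈D))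
      C-x⊆X∪y : C - x ⊆ X ∪ ⁅ y ⁆
      C-x⊆X∪y {z} z∈ with z ≟ᶠ y
      ... | yes refl = x∈p∪q⁺ (inj₂ (x∈⁅x⁆ z))
      ... | no z≢y = let z∈C , z≢x = x∈p-y⁻ z∈ in
        x∈p∪q⁺ (inj₁ (x∈p∧x≢y⇒x∈p-y (x∈p∧x≢y⇒x∈p-y (x∈p∪q⁺ (inj₁ z∈C)) z≢y) z≢x))
      X∪y⊆T₀ = ∪-lub X⊆T₀ (⁅x⁆⊆ (D⊆T₀ y∈D))
      x-spanned : r (X ∪ ⁅ x ⁆) ≤ r X
      x-spanned = begin
        r (X ∪ ⁅ x ⁆)           ≤⟨ rank-mono (∪-lub X⊆T₀ (⁅x⁆⊆ (C⊆T₀ x∈C))) (∪-lub X∪y⊆T₀ (⁅x⁆⊆ (C⊆T₀ x∈C)))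
                                             (∪-mono (p⊆p∪q ⁅ y ⁆) ⊆-refl) ⟩
        r ((X ∪ ⁅ y ⁆) ∪ ⁅ x ⁆) ≤⟨ circuit-spans cC C⊆T₀ X∪y⊆T₀ x∈C C-x⊆X∪y ⟩
        r (X ∪ ⁅ y ⁆)           ≤⟨ circuit-spans cD D⊆T₀ X⊆T₀ y∈D D-y⊆X ⟩
        r X                     ∎

  circuit-spans-subtransversal : ∀ {C Y e} → IsCircuit C → e ∈ C → C - e ⊆ Y
                               → IsSubtransversal (Y ∪ ⁅ e ⁆) → r (Y ∪ ⁅ e ⁆) ≤ r Y
  circuit-spans-subtransversal {C} {Y} {e} cC e∈C C-e⊆Y st with extend-to-transversal st
  ... | T₀ , trT₀ , Y∪e⊆T₀ =
    InTransversal.circuit-spans T₀ trT₀ cC (⊆-trans (p⊆p-x∪⁅x⁆ e) (⊆-trans (∪-mono C-e⊆Y ⊆-refl) Y∪e⊆T₀))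
      (⊆-trans (p⊆p∪q ⁅ e ⁆) Y∪e⊆T₀) e∈C C-e⊆Y

  circuit-elimination : ∀ {C D x y} → IsCircuit C → IsCircuit D → IsSubtransversal (C ∪ D)
                      → x ∈ C → x ∉ D → y ∈ C → y ∈ D
                      → ∃ λ K → IsCircuit K × x ∈ K × K ⊆ (C ∪ D) - y
  circuit-elimination {C} {D} cC cD st with extend-to-transversal st
  ... | T₀ , trT₀ , C∪D⊆T₀ =
    InTransversal.strong-circuit-elimination T₀ trT₀ cC cD (⊆-trans (p⊆p∪q D) C∪D⊆T₀) (⊆-trans (q⊆p∪q C D) C∪D⊆T₀)

  -- With S = (C - p) ∪ (D - q), both p and q are spanned by S, contradicting (R2).
  skew-circuits : ∀ {C D p q} → IsCircuit C → IsCircuit D → p ∈ C → q ∈ D → p ≢ q → cls p ≡ cls q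
                → ¬ IsSubtransversal ((C - p) ∪ (D - q))
  skew-circuits {C} {D} {p} {q} cC cD p∈C q∈D p≢q cp≡cq stS = m+1+n≰m (2 * r S) (begin
    2 * r S + 1                   ≤⟨ R2 S p q stS p≢q cp≡cq avoids-p ⟩
    r (S ∪ ⁅ p ⁆) + r (S ∪ ⁅ q ⁆) ≤⟨ +-mono-≤ (spans cC p∈C (p⊆p∪q (D - q)) avoids-p)
                                              (spans cD q∈D (q⊆p∪q (C - p) (D - q)) avoids-q) ⟩
    r S + r S                     ≡⟨ cong (r S +_) (sym (+-identityʳ (r S))) ⟩
    2 * r S                       ∎)
    where
    S = (C - p) ∪ (D - q)
    avoids-p : ∀ z → z ∈ S → cls z ≢ cls p
    avoids-p z z∈S with x∈p∪q⁻ (C - p) (D - q) z∈S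
    ... | inj₁ z∈C-p = distinct-classes (circuit⇒subtransversal cC) (proj₁ (x∈p-y⁻ z∈C-p)) p∈C (proj₂ (x∈p-y⁻ z∈C-p))
    ... | inj₂ z∈D-q = distinct-classes (circuit⇒subtransversal cD) (proj₁ (x∈p-y⁻ z∈D-q)) q∈D (proj₂ (x∈p-y⁻ z∈D-q))
                       ∘ (λ cz≡cp → trans cz≡cp cp≡cq)
    avoids-q : ∀ z → z ∈ S → cls z ≢ cls q
    avoids-q z z∈S cz≡cq = avoids-p z z∈S (trans cz≡cq (sym cp≡cq))
    spans : ∀ {K e} → IsCircuit K → e ∈ K → K - e ⊆ S → (∀ z → z ∈ S → cls z ≢ cls e)
          → r (S ∪ ⁅ e ⁆) ≤ r S
    spans cK e∈K K-e⊆S avoids = circuit-spans-subtransversal cK e∈K K-e⊆S (subtransversal-∪⁅⁆ stS avoids)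

module Witnesses (Z : Multimatroid) (_≺_ : Rel (Fin (Multimatroid.n Z)) 0ℓ)
                 (sto : IsStrictTotalOrder _≡_ _≺_) where
  open Multimatroid Z
  open MultimatroidNotions Z _≺_
  open Transversals carrier
  open Circuits Z _≺_
  open IsStrictTotalOrder sto using () renaming (_<?_ to _≺?_)

  min-≺ : ∀ {C x y} → IsMin C x → y ∈ C → y ≢ x → cls x ≺ cls y
  min-≺ (_ , least) y∈C y≢x = [ ⊥-elim ∘ y≢x , id ]′ (least _ y∈C)

  IsMin? : ∀ C x → Dec (IsMin C x)
  IsMin? C x = (x ∈? C) ×-dec all? λ y → (y ∈? C) →-dec ((y ≟ᶠ x) ⊎-dec (cls x ≺? cls y))

  ActiveWitness? : ∀ T x → Dec (ActiveWitness T x)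
  ActiveWitness? T x = anySubset? λ C →
    IsCircuit? C ×-dec IsMin? C x ×-dec all? λ y → (y ∈? C) →-dec ¬? (cls y ≟ᶠ cls x) →-dec (y ∈? T)

  IsActive? : ∀ T ω → Dec (IsActive T ω)
  IsActive? T ω = any? λ x → (cls x ≟ᶠ ω) ×-dec ActiveWitness? T x

  IsWitness : Subset m → Fin m → Subset m → Set
  IsWitness T x C = IsCircuit C × IsMin C x × C - x ⊆ T

  witness⇒activeWitness : ∀ {T x C} → IsWitness T x C → ActiveWitness T x
  witness⇒activeWitness {C = C} (cC , mC , C-x⊆T) =
    C , cC , mC , λ y y∈C cy≢cx → C-x⊆T (x∈p∧x≢y⇒x∈p-y y∈C (cy≢cx ∘ cong cls))

  activeWitness⇒witness : ∀ {T x} → ActiveWitness T x → ∃ (IsWitness T x)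
  activeWitness⇒witness (C , cC , mC , rest) = C , cC , mC , λ y∈C-x →
    let y∈C , y≢x = x∈p-y⁻ y∈C-x in rest _ y∈C (distinct-classes (circuit⇒subtransversal cC) y∈C (proj₁ mC) y≢x)

module CocompatibleClosure (Z : Multimatroid) (_≺_ : Rel (Fin (Multimatroid.n Z)) 0ℓ)
                           (sto : IsStrictTotalOrder _≡_ _≺_)
                           (T : Subset (Multimatroid.m Z)) (trT : Multimatroid.IsTransversal Z T) where
  open Multimatroid Z
  open MultimatroidNotions Z _≺_
  open Transversals carrier
  open Circuits Z _≺_
  open Witnesses Z _≺_ sto
  open IsStrictTotalOrder sto using (irrefl; asym) renaming (trans to ≺-trans)

  witness-unique : ∀ {x y} → ActiveWitness T x → ActiveWitness T y → cls x ≡ cls y → x ≡ y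
  witness-unique {x} {y} wx wy cx≡cy with x ≟ᶠ y | activeWitness⇒witness wx | activeWitness⇒witness wy
  ... | yes x≡y | _ | _ = x≡y
  ... | no x≢y | C , cC , (x∈C , _) , C-x⊆T | D , cD , (y∈D , _) , D-y⊆T =
    ⊥-elim (skew-circuits cC cD x∈C y∈D x≢y cx≡cy (subtransversal-⊆ (proj₁ trT) (∪-lub C-x⊆T D-y⊆T)))

  ccl-exists : ∃ (IsCcl T)
  ccl-exists = select InCcl? , (st* , covers*) , characterised
    where
    InCcl : Fin m → Set
    InCcl w = ActiveWitness T w ⊎ (¬ IsActive T (cls w) × w ∈ T)
    InCcl? : ∀ w → Dec (InCcl w)
    InCcl? w = ActiveWitness? T w ⊎-dec (¬? (IsActive? T (cls w)) ×-dec (w ∈? T))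
    st* : IsSubtransversal (select InCcl?)
    st* x y x∈ y∈ cx≡cy with ∈-select⁻ InCcl? x∈ | ∈-select⁻ InCcl? y∈
    ... | inj₁ wx              | inj₁ wy              = witness-unique wx wy cx≡cy
    ... | inj₁ wx              | inj₂ (inactive , _)  = ⊥-elim (inactive (x , cx≡cy , wx))
    ... | inj₂ (inactive , _)  | inj₁ wy              = ⊥-elim (inactive (y , sym cx≡cy , wy))
    ... | inj₂ (_ , x∈T)       | inj₂ (_ , y∈T)       = proj₁ trT x y x∈T y∈T cx≡cy
    covers* : ∀ ω → ∃ λ x → x ∈ select InCcl? × cls x ≡ ω
    covers* ω with IsActive? T ω | proj₂ trT ω
    ... | yes (x , cx≡ω , wx) | _ = x , ∈-select⁺ InCcl? (inj₁ wx) , cx≡ω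
    ... | no inactive | y , y∈T , cy≡ω =
      y , ∈-select⁺ InCcl? (inj₂ (inactive ∘ subst (IsActive T) cy≡ω , y∈T)) , cy≡ω
    characterised : ∀ x → x ∈ select InCcl?
                  → (IsActive T (cls x) → ActiveWitness T x) × (¬ IsActive T (cls x) → x ∈ T)
    characterised x x∈ with ∈-select⁻ InCcl? x∈
    ... | inj₁ wx = (λ _ → wx) , (λ inactive → ⊥-elim (inactive (x , refl , wx)))
    ... | inj₂ (inactive , x∈T) = ⊥-elim ∘ inactive , λ _ → x∈T

  -- (C - y) ∪ (D - z) ⊆ T ∪ ⁅ x ⁆, and x is alone in its class there because the
  -- classes of D - z lie above cls z = cls y, which lies above cls x.
  witness-agrees : ∀ {x y z C D} → IsWitness T x C → IsWitness T z D → y ∈ C - x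
                 → cls z ≡ cls y → z ≡ y
  witness-agrees {x} {y} {z} {C} {D} (cC , mC , C-x⊆T) (cD , mD , D-z⊆T) y∈C-x cz≡cy with z ≟ᶠ y
  ... | yes z≡y = z≡y
  ... | no z≢y = ⊥-elim (skew-circuits cC cD y∈C (proj₁ mD) (z≢y ∘ sym) (sym cz≡cy)
                   (subtransversal-∪ (subtransversal-⊆ (circuit⇒subtransversal cC) (p─q⊆p C ⁅ y ⁆))
                                      (subtransversal-⊆ (circuit⇒subtransversal cD) (p─q⊆p D ⁅ z ⁆)) agree))
    where
    y∈C = proj₁ (x∈p-y⁻ y∈C-x)
    x≺y = min-≺ mC y∈C (proj₂ (x∈p-y⁻ y∈C-x))
    agree : ∀ {u v} → u ∈ C - y → v ∈ D - z → cls u ≡ cls v → u ≡ v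
    agree {u} {v} u∈ v∈ cu≡cv with u ≟ᶠ x
    ... | yes refl = ⊥-elim (irrefl cu≡cv (≺-trans x≺y (subst (_≺ cls v) cz≡cy (min-≺ mD v∈D v≢z))))
      where
      v∈D = proj₁ (x∈p-y⁻ v∈)
      v≢z = proj₂ (x∈p-y⁻ v∈)
    ... | no u≢x = proj₁ trT u v (C-x⊆T (x∈p∧x≢y⇒x∈p-y (proj₁ (x∈p-y⁻ u∈)) u≢x)) (D-z⊆T v∈) cu≡cv

  module ClosureOf (T′ : Subset m) (ccl : IsCcl T T′) where

    ccl-active : ∀ {z} → z ∈ T′ → IsActive T (cls z) → ActiveWitness T z
    ccl-active z∈T′ = proj₁ (proj₂ ccl _ z∈T′)

    ccl-inactive : ∀ {z} → z ∈ T′ → ¬ IsActive T (cls z) → z ∈ T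
    ccl-inactive z∈T′ = proj₂ (proj₂ ccl _ z∈T′)

    witness∈ccl : ∀ {x} → ActiveWitness T x → x ∈ T′
    witness∈ccl {x} wx with proj₂ (proj₁ ccl) (cls x)
    ... | z , z∈T′ , cz≡cx =
      subst (_∈ T′) (witness-unique (ccl-active z∈T′ (x , sym cz≡cx , wx)) wx cz≡cx) z∈T′

    ccl∖T⇒witness : ∀ {x} → x ∈ T′ → x ∉ T → ActiveWitness T x
    ccl∖T⇒witness {x} x∈T′ x∉T with IsActive? T (cls x)
    ... | yes active = ccl-active x∈T′ active
    ... | no inactive = ⊥-elim (x∉T (ccl-inactive x∈T′ inactive))

    witness-lift : ∀ {x C} → IsWitness T x C → IsWitness T′ x C
    witness-lift {x} {C} wC@(cC , mC , C-x⊆T) = cC , mC , C-x⊆T′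
      where
      C-x⊆T′ : C - x ⊆ T′
      C-x⊆T′ {y} y∈C-x with proj₂ (proj₁ ccl) (cls y)
      ... | z , z∈T′ , cz≡cy = subst (_∈ T′) z≡y z∈T′
        where
        z≡y : z ≡ y
        z≡y with IsActive? T (cls z)
        ... | yes active = witness-agrees wC (proj₂ (activeWitness⇒witness (ccl-active z∈T′ active))) y∈C-x cz≡cy
        ... | no inactive = proj₁ trT z y (ccl-inactive z∈T′ inactive) (C-x⊆T y∈C-x) cz≡cy

    outsider-witness : ∀ {x y C} → IsWitness (T ∪ T′) x C → y ∈ (C - x) ─ T → ∃ (IsWitness T y)
    outsider-witness (_ , _ , C-x⊆T∪T′) y-out with x∈p─q⁻ y-out
    ... | y∈C-x , y∉T = activeWitness⇒witness (ccl∖T⇒witness y∈T′ y∉T)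
      where
      y∈T′ = [ ⊥-elim ∘ y∉T , id ]′ (x∈p∪q⁻ T T′ (C-x⊆T∪T′ y∈C-x))

    -- Eliminating y between C and the T-witness D of y leaves a circuit with least
    -- element x and fewer elements outside T.
    module Elimination {x y C D} (wC : IsWitness (T ∪ T′) x C) (y-out : y ∈ (C - x) ─ T)
                       (y-max : ∀ {u} → u ∈ (C - x) ─ T → ¬ (cls y ≺ cls u))
                       (wD : IsWitness T y D) where

      y∈C : y ∈ C
      y∈C = proj₁ (x∈p-y⁻ (proj₁ (x∈p─q⁻ y-out)))

      y∉T : y ∉ T
      y∉T = proj₂ (x∈p─q⁻ y-out)

      x≺y : cls x ≺ cls y
      x≺y = min-≺ (proj₁ (proj₂ wC)) y∈C (proj₂ (x∈p-y⁻ (proj₁ (x∈p─q⁻ y-out))))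

      y≺D-y : ∀ {u} → u ∈ D - y → cls y ≺ cls u
      y≺D-y u∈ = min-≺ (proj₁ (proj₂ wD)) (proj₁ (x∈p-y⁻ u∈)) (proj₂ (x∈p-y⁻ u∈))

      x∉D : x ∉ D
      x∉D x∈D = irrefl refl (≺-trans x≺y (y≺D-y (x∈p∧x≢y⇒x∈p-y x∈D (λ x≡y → irrefl (cong cls x≡y) x≺y))))

      -- An element of C in the class of some v ∈ D - y lies above y, so it lies in T
      -- by the maximality of y, and then equals v.
      C∪D-subtransversal : IsSubtransversal (C ∪ D)
      C∪D-subtransversal = subtransversal-∪ (circuit⇒subtransversal (proj₁ wC)) (circuit⇒subtransversal (proj₁ wD)) agree
        where
        agree : ∀ {u v} → u ∈ C → v ∈ D → cls u ≡ cls v → u ≡ v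
        agree {u} {v} u∈C v∈D cu≡cv with v ≟ᶠ y | u ∈? T
        ... | yes refl | _ = circuit⇒subtransversal (proj₁ wC) u v u∈C y∈C cu≡cv
        ... | no v≢y | yes u∈T = proj₁ trT u v u∈T (proj₂ (proj₂ wD) (x∈p∧x≢y⇒x∈p-y v∈D v≢y)) cu≡cv
        ... | no v≢y | no u∉T = ⊥-elim (y-max (x∈p∧x∉q⇒x∈p─q (x∈p∧x≢y⇒x∈p-y u∈C u≢x) u∉T) y≺u)
          where
          y≺u : cls y ≺ cls u
          y≺u = subst (cls y ≺_) (sym cu≡cv) (y≺D-y (x∈p∧x≢y⇒x∈p-y v∈D v≢y))
          u≢x : u ≢ x
          u≢x refl = asym x≺y y≺u

      module _ {K} (K⊆C∪D-y : K ⊆ (C ∪ D) - y) where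

        K-cases : ∀ {z} → z ∈ K → z ∈ C ⊎ z ∈ D - y
        K-cases z∈K with x∈p-y⁻ (K⊆C∪D-y z∈K)
        ... | z∈C∪D , z≢y = [ inj₁ , (λ z∈D → inj₂ (x∈p∧x≢y⇒x∈p-y z∈D z≢y)) ]′ (x∈p∪q⁻ C D z∈C∪D)

        K-least : ∀ z → z ∈ K → z ≡ x ⊎ cls x ≺ cls z
        K-least z z∈K =
          [ proj₂ (proj₁ (proj₂ wC)) z , (λ z∈D-y → inj₂ (≺-trans x≺y (y≺D-y z∈D-y))) ]′ (K-cases z∈K)

        K-x⊆T∪T′ : K - x ⊆ T ∪ T′
        K-x⊆T∪T′ z∈ with x∈p-y⁻ z∈
        ... | z∈K , z≢x = [ (λ z∈C → proj₂ (proj₂ wC) (x∈p∧x≢y⇒x∈p-y z∈C z≢x)) , p⊆p∪q T′ ∘ proj₂ (proj₂ wD) ]′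
                            (K-cases z∈K)

        K─T⊂C─T : K ─ T ⊂ C ─ T
        K─T⊂C─T = K─T⊆C─T , y , x∈p∧x∉q⇒x∈p─q y∈C y∉T , y∉K─T
          where
          K─T⊆C─T : K ─ T ⊆ C ─ T
          K─T⊆C─T z∈ with x∈p─q⁻ z∈
          ... | z∈K , z∉T = [ (λ z∈C → x∈p∧x∉q⇒x∈p─q z∈C z∉T) , ⊥-elim ∘ z∉T ∘ proj₂ (proj₂ wD) ]′ (K-cases z∈K)
          y∉K─T : y ∉ K ─ T
          y∉K─T y∈K─T = proj₂ (x∈p-y⁻ (K⊆C∪D-y (proj₁ (x∈p─q⁻ y∈K─T)))) refl

      smaller-witness : ∃ λ K → IsWitness (T ∪ T′) x K × K ─ T ⊂ C ─ T
      smaller-witness with circuit-elimination (proj₁ wC) (proj₁ wD) C∪D-subtransversal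
                             (proj₁ (proj₁ (proj₂ wC))) x∉D y∈C (proj₁ (proj₁ (proj₂ wD)))
      ... | K , cK , x∈K , K⊆C∪D-y =
        K , (cK , (x∈K , K-least K⊆C∪D-y) , K-x⊆T∪T′ K⊆C∪D-y) , K─T⊂C─T K⊆C∪D-y

    witness-reflect : ∀ {x C} → IsWitness (T ∪ T′) x C → ∃ (IsWitness T x)
    witness-reflect {x} {C} = descend (On.wellFounded (_─ T) ⊂-wellFounded C)
      where
      descend : ∀ {C} → Acc (_⊂_ on (_─ T)) C → IsWitness (T ∪ T′) x C → ∃ (IsWitness T x)
      descend {C} (acc smaller) wC with nonempty? ((C - x) ─ T)
      ... | no none = C , proj₁ wC , proj₁ (proj₂ wC) ,
                      λ {z} z∈ → decidable-stable (z ∈? T) (λ z∉T → none (z , x∈p∧x∉q⇒x∈p─q z∈ z∉T))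
      ... | yes outsider with maximal-element sto cls outsider
      ... | y , y-out , y-max with outsider-witness wC y-out
      ... | D , wD with Elimination.smaller-witness wC y-out y-max wD
      ... | K , wK , K─T⊂C─T = descend (smaller K─T⊂C─T) wK

    activeWitness-reflect : ∀ {x} → ActiveWitness T′ x → ActiveWitness T x
    activeWitness-reflect wx with activeWitness⇒witness wx
    ... | C , cC , mC , C-x⊆T′ = witness⇒activeWitness (proj₂ (witness-reflect (cC , mC , q⊆p∪q T T′ ∘ C-x⊆T′)))

    active-iff : ∀ ω → IsActive T ω ⇔ IsActive T′ ω
    active-iff ω = mk⇔
      (λ { (x , cx≡ω , wx) → x , cx≡ω , witness⇒activeWitness (witness-lift (proj₂ (activeWitness⇒witness wx))) })
      (λ { (x , cx≡ω , wx) → x , cx≡ω , activeWitness-reflect wx })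

    ccl-idempotent : ∀ {T″} → IsCcl T′ T″ → T″ ≡ T′
    ccl-idempotent {T″} ccl′ = transversal-⊆⇒≡ (proj₁ ccl′) (proj₁ (proj₁ ccl)) T″⊆T′
      where
      T″⊆T′ : T″ ⊆ T′
      T″⊆T′ {x} x∈T″ with IsActive? T′ (cls x)
      ... | yes active = witness∈ccl (activeWitness-reflect (proj₁ (proj₂ ccl′ x x∈T″) active))
      ... | no inactive = proj₂ (proj₂ ccl′ x x∈T″) inactive

    ccl-cocompatible : IsCocompatible T′
    ccl-cocompatible (C , x , cC , mC , x∉T′ , C-x⊆T′) =
      x∉T′ (witness∈ccl (activeWitness-reflect (C , cC , mC , λ y y∈C cy≢cx → C-x⊆T′ y y∈C (cy≢cx ∘ cong cls))))

proposition4p7 : (Z : Multimatroid)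
    → (_≺_ : Rel (Fin (Multimatroid.n Z)) 0ℓ) → IsStrictTotalOrder _≡_ _≺_
    → (T : Subset (Multimatroid.m Z))
    → Multimatroid.IsTransversal Z T
    → (∃ λ T' → MultimatroidNotions.IsCcl Z _≺_ T T')
      × (∀ T' → MultimatroidNotions.IsCcl Z _≺_ T T'
         → (∀ ω → MultimatroidNotions.IsActive Z _≺_ T ω ⇔ MultimatroidNotions.IsActive Z _≺_ T' ω)
           × (∀ T'' → MultimatroidNotions.IsCcl Z _≺_ T' T'' → T'' ≡ T')
           × MultimatroidNotions.IsCocompatible Z _≺_ T')
proposition4p7 Z _≺_ sto T trT = ccl-exists , λ T′ ccl →
  let open ClosureOf T′ ccl in active-iff , (λ _ → ccl-idempotent) , ccl-cocompatible
  where
  open CocompatibleClosure Z _≺_ sto T trT
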